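{- Let $q$ be a power of an odd prime with $q\equiv 3\pmod 4$ and $F=F_{2,1}(x)=x^2\big(1+\eta(x)\big)$ over $\mathbb{F}_q$. For any $b\in\mathbb{F}_q^*$, $\beta_F(1,b)=\#A_{00,01}(b)+\#A_{00,10}(b)+\#A_{01,00}(b)+\#A_{10,00}(b)\le 2$. Moreover, $\beta_F(1,b)=2$ if and only if $\#A_{00,01}(b)=\#A_{00,10}(b)=1$ or $\#A_{01,00}(b)=\#A_{10,00}(b)=1$.
   Context: $\eta$ is the quadratic character of $\mathbb{F}_q$ ($\eta(0)=0$, $\eta=1$ on nonzero squares, $-1$ on non-squares). $C_{00}=\{x:\eta(x)=\eta(x+1)=1\}$, $C_{01}=\{x:\eta(x)=1,\eta(x+1)=-1\}$, $C_{10}=\{x:\eta(x)=-1,\eta(x+1)=1\}$, $C_{11}=\{x:\eta(x)=\eta(x+1)=-1\}$. $\beta_F(1,b)$ is the number of $(x,y)\in\mathbb{F}_q^2$ with $F(x)-F(y)=b$ and $F(x+1)-F(y+1)=b$; for $i,j,k,l\in\{0,1\}$, $A_{ij,kl}(b)$ is the set of such solutions $(x,y)$ lying in $C_{ij}\times C_{kl}$. -}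

module Defs where

open import Level using (0ℓ)
open import Algebra.Bundles using (CommutativeRing)
open import Data.Nat using (ℕ)
open import Data.Integer using (ℤ; +_; -[1+_]; +[1+_])
open import Data.Fin using (Fin)
open import Data.Fin.Properties using (any?)
open import Data.Bool using (Bool; true; false; _∧_; if_then_else_)
open import Data.List using (List; length; filterᵇ; cartesianProduct; allFin)
open import Data.Product using (Σ; ∃; _×_; _,_)
open import Relation.Nullary using (¬_; does)
open import Relation.Binary.Definitions using (Decidable)
open import Relation.Binary.PropositionalEquality using (_≡_)

record FiniteField (q : ℕ) : Set₁ where
  field
    cring    : CommutativeRing 0ℓ 0ℓ
  open CommutativeRing cring public
  field
    _≟_      : Decidable _≈_
    0≉1      : ¬ (0# ≈ 1#)
    inverse  : ∀ x → ¬ (x ≈ 0#) → ∃ λ y → x * y ≈ 1#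
    enum     : Fin q → Carrier
    enum-inj : ∀ i j → enum i ≈ enum j → i ≡ j
    enum-sur : ∀ x → ∃ λ i → enum i ≈ x

module _ {q : ℕ} (K : FiniteField q) where
  open FiniteField K

  embedℕ : ℕ → Carrier
  embedℕ ℕ.zero    = 0#
  embedℕ (ℕ.suc n) = 1# + embedℕ n

  embed : ℤ → Carrier
  embed (+ n)      = embedℕ n
  embed -[1+ n ]   = - (embedℕ (ℕ.suc n))

  η : Carrier → ℤ
  η x = if does (x ≟ 0#) then + 0
        else if does (any? (λ i → (enum i * enum i) ≟ x)) then + 1
        else -[1+ 0 ]

  F : Carrier → Carrier
  F x = (x * x) * (1# + embed (η x))

  isℤ : ℤ → ℤ → Bool
  isℤ a b = does (a Data.Integer.≟ b)

  -- membership in C_{ij}; index 0 means η = 1, index 1 means η = -1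
  sgn : Fin 2 → ℤ
  sgn Fin.zero       = + 1
  sgn (Fin.suc _)    = -[1+ 0 ]

  inC : Fin 2 → Fin 2 → Carrier → Bool
  inC i j x = isℤ (η x) (sgn i) ∧ isℤ (η (x + 1#)) (sgn j)

  isSol : Carrier → Carrier → Carrier → Bool
  isSol b x y = does ((F x - F y) ≟ b)
              ∧ does ((F (x + 1#) - F (y + 1#)) ≟ b)

  pairs : List (Fin q × Fin q)
  pairs = cartesianProduct (allFin q) (allFin q)

  countPairs : (Carrier → Carrier → Bool) → ℕ
  countPairs P = length (filterᵇ (λ { (i , j) → P (enum i) (enum j) }) pairs)

  βF : Carrier → ℕ
  βF b = countPairs (isSol b)

  #A : Fin 2 → Fin 2 → Fin 2 → Fin 2 → Carrier → ℕ
  #A i j k l b = countPairs (λ x y → isSol b x y ∧ inC i j x ∧ inC k l y)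

module Submission where

-- F vanishes off the quadratic residues and is 2u² at a residue u. Since q ≡ 3 (mod 4), 2 ≠ 0
-- (else x ↦ x + 1 would pair off the q elements of K) and -1 is a nonsquare (else x ↦ ιx with
-- ι² = -1 would split K^× into orbits of size 4); in particular u² = v² forces u = v for
-- residues u, v. For b ≠ 0, comparing F(x) - F(y) = b with F(x+1) - F(y+1) = b excludes every
-- distribution of residues among x, x+1, y, y+1 except the classes C00×C01, C00×C10, C01×C00 and
-- C10×C00. In each class one equation reads 2u² = ±b for a residue u, which fixes u, and the other
-- equation then fixes the remaining coordinate, so each class holds at most one solution. The
-- first two classes force b = 2a² and the last two -b = 2c² with c ≠ 0, which is impossible
-- simultaneously because -1 is a nonsquare.

open import Defs
open import Data.Nat using (ℕ)
open import Data.Bool using (Bool; true; false; not; T; _∧_; if_then_else_)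
open import Data.Bool.Properties using (∧-zeroʳ; ∧-identityʳ; not-involutive; T-∧; T-≡)
open import Data.Empty using (⊥; ⊥-elim)
open import Data.Fin as Fin using (Fin)
open import Data.Fin.Patterns using (0F; 1F)
open import Data.Product using (∃; _×_; _,_; proj₁; proj₂; swap)
open import Data.Sum using (_⊎_; inj₁; inj₂; [_,_])
open import Function using (_∘_; _⇔_; mk⇔; Equivalence)
open import Relation.Nullary using (¬_; Dec; yes; no; does; ¬?; _×-dec_)
import Relation.Nullary.Decidable as Dec
import Relation.Binary.PropositionalEquality as ≡
open ≡ using (_≡_; _≢_)

T-does : ∀ {A : Set} (a? : Dec A) → T (does a?) → A
T-does (yes a) _ = a

T-not-does : ∀ {A : Set} (a? : Dec A) → T (not (does a?)) → ¬ A
T-not-does (yes _) ()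
T-not-does (no ¬a) _ = ¬a

module Counting where

  open import Data.Nat using (zero; suc; _+_; _*_; _≤_; z≤n; s≤s)
  open import Data.Nat.Properties using (+-0-commutativeMonoid; +-identityʳ; ≤-refl)
  open import Data.Nat.Divisibility using (_∣_; divides; n∣m⇒m%n≡0)
  open import Data.Nat.DivMod using (_%_; m∣n⇒o%n%m≡o%m; %-distribˡ-+)
  open import Data.Nat.Solver using (module +-*-Solver)
  open +-*-Solver using (solve; _:+_; _:*_; con; _:=_)
  open import Data.Fin.Properties using (_<?_; _≟_; <-cmp)
  open import Data.Fin.Permutation using (Permutation′; permutation; _⟨$⟩ʳ_)
  open import Data.List using (List; []; _∷_; length; filterᵇ)
  open import Data.List.Properties using (filter-none)
  import Data.List.Relation.Unary.All as All
  open All using (_∷_)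
  open import Data.List.Relation.Unary.Any using (here; there)
  open import Data.List.Relation.Unary.AllPairs using () renaming (_∷_ to _∷ᴾ_)
  open import Data.List.Relation.Unary.Unique.Propositional using (Unique)
  open import Data.List.Relation.Unary.Unique.Propositional.Properties using (filter⁺)
  open import Data.List.Membership.Propositional using (_∈_)
  open import Data.List.Membership.Propositional.Properties using (∈-filter⁻)
  open import Relation.Binary.Definitions using (tri<; tri≈; tri>)
  open import Relation.Nullary.Decidable using (T?; dec-true; dec-false)
  open import Algebra.Properties.CommutativeMonoid.Sum +-0-commutativeMonoid
    using (sum; sum-permute; ∑-distrib-+; sum-cong-≗)
  open ≡ using (refl; sym; trans; cong; cong₂; subst; module ≡-Reasoning)

  indicator : Bool → ℕ
  indicator true  = 1
  indicator false = 0

  count : ∀ {n} → (Fin n → Bool) → ℕ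
  count P = sum (indicator ∘ P)

  module _ {n : ℕ} where

    count-cong : {P Q : Fin n → Bool} → (∀ i → P i ≡ Q i) → count P ≡ count Q
    count-cong P≗Q = sum-cong-≗ (cong indicator ∘ P≗Q)

    count-permute : (π : Permutation′ n) (P : Fin n → Bool) → count P ≡ count (P ∘ (π ⟨$⟩ʳ_))
    count-permute π P = sum-permute (indicator ∘ P) π

    count-split : (P Q : Fin n → Bool) →
                  count P ≡ count (λ i → P i ∧ Q i) + count (λ i → P i ∧ not (Q i))
    count-split P Q = trans (sum-cong-≗ split) (∑-distrib-+ (λ i → indicator (P i ∧ Q i)) _)
      where
      split : ∀ i → indicator (P i) ≡ indicator (P i ∧ Q i) + indicator (P i ∧ not (Q i))
      split i with P i | Q i
      ... | true  | true  = refl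
      ... | true  | false = refl
      ... | false | _     = refl

  count-true : ∀ n → count {n} (λ _ → true) ≡ n
  count-true zero    = refl
  count-true (suc n) = cong suc (count-true n)

  count-false : ∀ n → count {n} (λ _ → false) ≡ 0
  count-false zero    = refl
  count-false (suc n) = count-false n

  count-≟ : ∀ {n} (j : Fin n) → count (λ i → does (i ≟ j)) ≡ 1
  count-≟ {suc n} Fin.zero    = cong suc (count-false n)
  count-≟ {suc n} (Fin.suc j) = count-≟ j

  _<ᵇ_ : ∀ {n} → Fin n → Fin n → Bool
  i <ᵇ j = does (i <? j)

  not-<ᵇ : ∀ {n} {i j : Fin n} → i ≢ j → not (i <ᵇ j) ≡ j <ᵇ i
  not-<ᵇ {i = i} {j} i≢j with <-cmp i j
  ... | tri< i<j _ j≮i = trans (cong not (dec-true (i <? j) i<j)) (sym (dec-false (j <? i) j≮i))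
  ... | tri≈ _ i≡j _   = ⊥-elim (i≢j i≡j)
  ... | tri> i≮j _ j<i = trans (cong not (dec-false (i <? j) i≮j)) (sym (dec-true (j <? i) j<i))

  module _ {n : ℕ} (P : Fin n → Bool) where

    involution-count : (σ : Fin n → Fin n) → (∀ i → σ (σ i) ≡ i) → (∀ i → P (σ i) ≡ P i) →
                       (∀ i → T (P i) → σ i ≢ i) →
                       count P ≡ count (λ i → P i ∧ i <ᵇ σ i) + count (λ i → P i ∧ i <ᵇ σ i)
    involution-count σ σσ P-inv free = begin
      count P                                                   ≡⟨ count-split P (λ i → i <ᵇ σ i) ⟩
      count Below + count (λ i → P i ∧ not (i <ᵇ σ i))          ≡⟨ cong (count Below +_) (count-cong above) ⟩
      count Below + count (Below ∘ (π ⟨$⟩ʳ_))                   ≡⟨ cong (count Below +_) (count-permute π Below) ⟨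
      count Below + count Below                                 ∎
      where
      open ≡-Reasoning
      Below : Fin n → Bool
      Below i = P i ∧ i <ᵇ σ i
      π : Permutation′ n
      π = permutation σ σ σσ σσ
      above : ∀ i → (P i ∧ not (i <ᵇ σ i)) ≡ Below (σ i)
      above i rewrite σσ i | P-inv i with P i in Pi
      ... | true  = not-<ᵇ (λ i≡σi → free i (subst T (sym Pi) _) (sym i≡σi))
      ... | false = refl

    involution⇒2∣count : (σ : Fin n → Fin n) → (∀ i → σ (σ i) ≡ i) → (∀ i → P (σ i) ≡ P i) →
                         (∀ i → T (P i) → σ i ≢ i) → 2 ∣ count P
    involution⇒2∣count σ σσ P-inv free =
      divides (count Below) (trans (involution-count σ σσ P-inv free)
                                   (solve 1 (λ c → c :+ c := c :* con 2) refl (count Below)))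
      where Below = λ i → P i ∧ i <ᵇ σ i

    -- Each orbit {i, σ i, σ² i, σ³ i} in P has exactly one element with i < σ² i and σ i < σ³ i.
    order4⇒4∣count : (σ : Fin n → Fin n) → (∀ i → σ (σ (σ (σ i))) ≡ i) → (∀ i → P (σ i) ≡ P i) →
                   (∀ i → T (P i) → σ (σ i) ≢ i) → 4 ∣ count P
    order4⇒4∣count σ σ⁴ P-inv free = divides (count Lowest) (begin
      count P                                      ≡⟨ involution-count (σ ∘ σ) σ⁴ P-inv² free ⟩
      count Below + count Below                    ≡⟨ cong (λ c → c + c) Below-halves ⟩
      (count Lowest + count Lowest) + (count Lowest + count Lowest)
                                                   ≡⟨ solve 1 (λ c → (c :+ c) :+ (c :+ c) := c :* con 4) refl (count Lowest) ⟩
      count Lowest * 4                             ∎)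
      where
      open ≡-Reasoning
      P-inv² : ∀ i → P (σ (σ i)) ≡ P i
      P-inv² i = trans (P-inv (σ i)) (P-inv i)
      Below Lowest : Fin n → Bool
      Below i = P i ∧ i <ᵇ σ (σ i)
      Lowest i = Below i ∧ σ i <ᵇ σ (σ (σ i))
      σ³ : Fin n → Fin n
      σ³ i = σ (σ (σ i))
      π : Permutation′ n
      π = permutation σ³ σ σ⁴ σ⁴
      rotate : ∀ i → (Below i ∧ not (σ i <ᵇ σ (σ (σ i)))) ≡ Lowest (σ³ i)
      rotate i rewrite σ⁴ i | P-inv² (σ i) | P-inv i with P i in Pi | i <ᵇ σ (σ i)
      ... | false | _     = refl
      ... | true  | false = sym (∧-zeroʳ _)
      ... | true  | true  = trans (not-<ᵇ {i = σ i} (λ σi≡σ³i → free (σ i) (subst T (sym (trans (P-inv i) Pi)) _) (sym σi≡σ³i)))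
                                  (sym (∧-identityʳ _))
      Below-halves : count Below ≡ count Lowest + count Lowest
      Below-halves = begin
        count Below                                                      ≡⟨ count-split Below (λ i → σ i <ᵇ σ (σ (σ i))) ⟩
        count Lowest + count (λ i → Below i ∧ not (σ i <ᵇ σ (σ (σ i))))  ≡⟨ cong (count Lowest +_) (count-cong rotate) ⟩
        count Lowest + count (Lowest ∘ (π ⟨$⟩ʳ_))                        ≡⟨ cong (count Lowest +_) (count-permute π Lowest) ⟨
        count Lowest + count Lowest                                      ∎

  module _ {A : Set} where

    length-filterᵇ-∷ : (p : A → Bool) (x : A) (xs : List A) →
                       length (filterᵇ p (x ∷ xs)) ≡ indicator (p x) + length (filterᵇ p xs)
    length-filterᵇ-∷ p x xs with p x
    ... | true  = refl
    ... | false = refl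

    length-filterᵇ-+₄ : (p p₁ p₂ p₃ p₄ : A → Bool) →
      (∀ x → indicator (p x) ≡ indicator (p₁ x) + indicator (p₂ x) + indicator (p₃ x) + indicator (p₄ x)) →
      ∀ xs → length (filterᵇ p xs) ≡ length (filterᵇ p₁ xs) + length (filterᵇ p₂ xs)
                                      + length (filterᵇ p₃ xs) + length (filterᵇ p₄ xs)
    length-filterᵇ-+₄ p p₁ p₂ p₃ p₄ split []       = refl
    length-filterᵇ-+₄ p p₁ p₂ p₃ p₄ split (x ∷ xs) = begin
      length (filterᵇ p (x ∷ xs))                  ≡⟨ length-filterᵇ-∷ p x xs ⟩
      indicator (p x) + #p                         ≡⟨ cong₂ _+_ (split x) (length-filterᵇ-+₄ p p₁ p₂ p₃ p₄ split xs) ⟩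
      (i₁ + i₂ + i₃ + i₄) + (#p₁ + #p₂ + #p₃ + #p₄) ≡⟨ solve 8 (λ a b c d e f g h → (a :+ b :+ c :+ d) :+ (e :+ f :+ g :+ h)
                                                              := (a :+ e) :+ (b :+ f) :+ (c :+ g) :+ (d :+ h))
                                                       refl i₁ i₂ i₃ i₄ #p₁ #p₂ #p₃ #p₄ ⟩
      (i₁ + #p₁) + (i₂ + #p₂) + (i₃ + #p₃) + (i₄ + #p₄)
        ≡⟨ sym (cong₂ _+_ (cong₂ _+_ (cong₂ _+_ (length-filterᵇ-∷ p₁ x xs) (length-filterᵇ-∷ p₂ x xs))
                                     (length-filterᵇ-∷ p₃ x xs)) (length-filterᵇ-∷ p₄ x xs)) ⟩
      length (filterᵇ p₁ (x ∷ xs)) + length (filterᵇ p₂ (x ∷ xs))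
        + length (filterᵇ p₃ (x ∷ xs)) + length (filterᵇ p₄ (x ∷ xs)) ∎
      where
      open ≡-Reasoning
      #p = length (filterᵇ p xs)
      #p₁ = length (filterᵇ p₁ xs)
      #p₂ = length (filterᵇ p₂ xs)
      #p₃ = length (filterᵇ p₃ xs)
      #p₄ = length (filterᵇ p₄ xs)
      i₁ = indicator (p₁ x)
      i₂ = indicator (p₂ x)
      i₃ = indicator (p₃ x)
      i₄ = indicator (p₄ x)

    length-filterᵇ≡0 : (p : A → Bool) → (∀ x → ¬ T (p x)) → ∀ xs → length (filterᵇ p xs) ≡ 0
    length-filterᵇ≡0 p ¬p xs = cong length (filter-none (T? ∘ p) (All.universal ¬p xs))

    length≤1 : {ys : List A} → Unique ys → (∀ {x y} → x ∈ ys → y ∈ ys → x ≡ y) → length ys ≤ 1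
    length≤1 {[]}             _                    _     = z≤n
    length≤1 {_ ∷ []}         _                    _     = s≤s z≤n
    length≤1 {_ ∷ _ ∷ _} ((x≢y ∷ _) ∷ᴾ _) const = ⊥-elim (x≢y (const (here refl) (there (here refl))))

    length-filterᵇ≤1 : (p : A → Bool) {xs : List A} → Unique xs → (∀ {x y} → T (p x) → T (p y) → x ≡ y) →
                       length (filterᵇ p xs) ≤ 1
    length-filterᵇ≤1 p {xs} unique const = length≤1 (filter⁺ (T? ∘ p) unique)
      (λ x∈ y∈ → const (satisfies x∈) (satisfies y∈))
      where satisfies : ∀ {x} → x ∈ filterᵇ p xs → T (p x)
            satisfies x∈ = proj₂ (∈-filter⁻ (T? ∘ p) {xs = xs} x∈)

  module _ {q : ℕ} (q%4≡3 : q % 4 ≡ 3) where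

    q%4≡3⇒2∤q : ¬ 2 ∣ q
    q%4≡3⇒2∤q 2∣q with begin
        1              ≡⟨ cong (_% 2) q%4≡3 ⟨
        q % 4 % 2      ≡⟨ m∣n⇒o%n%m≡o%m 2 4 q (divides 2 refl) ⟩
        q % 2          ≡⟨ n∣m⇒m%n≡0 q 2 2∣q ⟩
        0              ∎
      where open ≡-Reasoning
    ... | ()

    q%4≡3⇒4∤q-1 : ∀ {m} → q ≡ m + 1 → ¬ 4 ∣ m
    q%4≡3⇒4∤q-1 {m} q≡m+1 4∣m with begin
        3                      ≡⟨ q%4≡3 ⟨
        q % 4                  ≡⟨ cong (_% 4) q≡m+1 ⟩
        (m + 1) % 4            ≡⟨ %-distribˡ-+ m 1 4 ⟩
        (m % 4 + 1 % 4) % 4    ≡⟨ cong (λ r → (r + 1) % 4) (n∣m⇒m%n≡0 m 4 4∣m) ⟩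
        1                      ∎
      where open ≡-Reasoning
    ... | ()

  two-bits : ∀ {a b} → a ≤ 1 → b ≤ 1 → a + b ≤ 2 × (a + b ≡ 2 ⇔ (a ≡ 1 × b ≡ 1))
  two-bits z≤n       z≤n       = z≤n , mk⇔ (λ ()) (λ { (() , _) })
  two-bits z≤n       (s≤s z≤n) = s≤s z≤n , mk⇔ (λ ()) (λ { (() , _) })
  two-bits (s≤s z≤n) z≤n       = s≤s z≤n , mk⇔ (λ ()) (λ { (_ , ()) })
  two-bits (s≤s z≤n) (s≤s z≤n) = ≤-refl , mk⇔ (λ _ → refl , refl) (λ _ → refl)

  four-bits : ∀ {a₁ a₂ a₃ a₄} → a₁ ≤ 1 → a₂ ≤ 1 → a₃ ≤ 1 → a₄ ≤ 1 →
    (a₁ ≡ 0 × a₂ ≡ 0) ⊎ (a₃ ≡ 0 × a₄ ≡ 0) →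
    (a₁ + a₂ + a₃ + a₄ ≤ 2) × (a₁ + a₂ + a₃ + a₄ ≡ 2 ⇔ ((a₁ ≡ 1 × a₂ ≡ 1) ⊎ (a₃ ≡ 1 × a₄ ≡ 1)))
  four-bits _ _ a₃≤1 a₄≤1 (inj₁ (refl , refl)) with two-bits a₃≤1 a₄≤1
  ... | ≤2 , ≡2⇔ = ≤2 , mk⇔ (inj₂ ∘ Equivalence.to ≡2⇔) [ (λ { (() , _) }) , Equivalence.from ≡2⇔ ]
  four-bits {a₁} {a₂} a₁≤1 a₂≤1 _ _ (inj₂ (refl , refl))
    rewrite +-identityʳ (a₁ + a₂ + 0) | +-identityʳ (a₁ + a₂) with two-bits a₁≤1 a₂≤1
  ... | ≤2 , ≡2⇔ = ≤2 , mk⇔ (inj₁ ∘ Equivalence.to ≡2⇔) [ Equivalence.from ≡2⇔ , (λ { (() , _) }) ]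

open Counting

module Properties {q : ℕ} (K : FiniteField q) where

  open import Data.Nat as ℕ using (_%_)
  open import Data.Nat.Divisibility using (_∣_)
  open import Data.Integer as ℤ using (ℤ; +_; -[1+_])
  open import Data.Fin.Properties using (any?)
  open import Data.List.Relation.Unary.Unique.Propositional.Properties using (cartesianProduct⁺; allFin⁺)
  open import Relation.Nullary.Decidable using (does-⇔)
  open FiniteField K
  open import Algebra.Properties.Group +-group using (∙-cancelˡ; ∙-cancelʳ)
  open import Algebra.Solver.Ring.NaturalCoefficients.Default commutativeSemiring
  open import Relation.Binary.Reasoning.Setoid setoid

  two : Carrier
  two = 1# + 1#

  +-cancelˡ : ∀ {a u v} → a + u ≈ a + v → u ≈ v
  +-cancelˡ = ∙-cancelˡ _ _ _

  +-cancelʳ : ∀ {a u v} → u + a ≈ v + a → u ≈ v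
  +-cancelʳ = ∙-cancelʳ _ _ _

  x-y≈b⇒x≈b+y : ∀ {x y b} → x - y ≈ b → x ≈ b + y
  x-y≈b⇒x≈b+y {x} {y} {b} x-y≈b = begin
    x              ≈⟨ +-identityʳ x ⟨
    x + 0#         ≈⟨ +-congˡ (-‿inverseˡ y) ⟨
    x + (- y + y)  ≈⟨ +-assoc x (- y) y ⟨
    (x - y) + y    ≈⟨ +-congʳ x-y≈b ⟩
    b + y          ∎

  x≈b+y⇒y≈-b+x : ∀ {x y b} → x ≈ b + y → y ≈ - b + x
  x≈b+y⇒y≈-b+x {x} {y} {b} x≈b+y = begin
    y              ≈⟨ +-identityˡ y ⟨
    0# + y         ≈⟨ +-congʳ (-‿inverseˡ b) ⟨
    (- b + b) + y  ≈⟨ +-assoc (- b) b y ⟩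
    - b + (b + y)  ≈⟨ +-congˡ x≈b+y ⟨
    - b + x        ∎

  x≉x+1 : ∀ {x} → ¬ x ≈ x + 1#
  x≉x+1 {x} x≈x+1 = 0≉1 (+-cancelˡ (trans (+-identityʳ x) x≈x+1))

  *-cancelˡ : ∀ {c u v} → ¬ c ≈ 0# → c * u ≈ c * v → u ≈ v
  *-cancelˡ {c} {u} {v} c≉0 cu≈cv = begin
    u                ≈⟨ *-identityˡ u ⟨
    1# * u           ≈⟨ *-congʳ c*c⁻¹≈1 ⟨
    (c * c⁻¹) * u    ≈⟨ solve 3 (λ c c⁻¹ u → (c :* c⁻¹) :* u := c⁻¹ :* (c :* u)) refl c c⁻¹ u ⟩
    c⁻¹ * (c * u)    ≈⟨ *-congˡ cu≈cv ⟩
    c⁻¹ * (c * v)    ≈⟨ solve 3 (λ c c⁻¹ v → c⁻¹ :* (c :* v) := (c :* c⁻¹) :* v) refl c c⁻¹ v ⟩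
    (c * c⁻¹) * v    ≈⟨ *-congʳ c*c⁻¹≈1 ⟩
    1# * v           ≈⟨ *-identityˡ v ⟩
    v                ∎
    where
    c⁻¹ = proj₁ (inverse c c≉0)
    c*c⁻¹≈1 = proj₂ (inverse c c≉0)

  *-cancelʳ : ∀ {c u v} → ¬ c ≈ 0# → u * c ≈ v * c → u ≈ v
  *-cancelʳ {c} {u} {v} c≉0 uc≈vc = *-cancelˡ c≉0 (trans (*-comm c u) (trans uc≈vc (*-comm v c)))

  x*y≈0⇒x≈0⊎y≈0 : ∀ {x y} → x * y ≈ 0# → x ≈ 0# ⊎ y ≈ 0#
  x*y≈0⇒x≈0⊎y≈0 {x} {y} xy≈0 with x ≟ 0#
  ... | yes x≈0 = inj₁ x≈0
  ... | no  x≉0 = inj₂ (*-cancelˡ x≉0 (trans xy≈0 (sym (zeroʳ x))))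

  transport : (Carrier → Carrier) → Fin q → Fin q
  transport f i = proj₁ (enum-sur (f (enum i)))

  enum-transport : ∀ f i → enum (transport f i) ≈ f (enum i)
  enum-transport f i = proj₂ (enum-sur (f (enum i)))

  nonzero : Fin q → Bool
  nonzero i = not (does (enum i ≟ 0#))

  q≡#nonzero+1 : q ≡ count nonzero ℕ.+ 1
  q≡#nonzero+1 = ≡.trans (≡.sym (count-true q)) (≡.trans (count-split (λ _ → true) nonzero)
                   (≡.cong (count nonzero ℕ.+_) (≡.trans (count-cong zero-at-z) (count-≟ z))))
    where
    z : Fin q
    z = proj₁ (enum-sur 0#)
    zero-at-z : ∀ i → not (nonzero i) ≡ does (i Fin.≟ z)
    zero-at-z i = ≡.trans (not-involutive _) (does-⇔ (mk⇔ to from) (enum i ≟ 0#) (i Fin.≟ z))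
      where
      to : enum i ≈ 0# → i ≡ z
      to i≈0 = enum-inj _ _ (trans i≈0 (sym (proj₂ (enum-sur 0#))))
      from : i ≡ z → enum i ≈ 0#
      from i≡z = trans (reflexive (≡.cong enum i≡z)) (proj₂ (enum-sur 0#))

  two≈0⇒2∣q : two ≈ 0# → 2 ∣ q
  two≈0⇒2∣q two≈0 =
    ≡.subst (2 ∣_) (count-true q) (involution⇒2∣count (λ _ → true) σ σσ (λ _ → ≡.refl) (λ i _ → σ-free i))
    where
    σ = transport (_+ 1#)
    σσ : ∀ i → σ (σ i) ≡ i
    σσ i = enum-inj _ _ (begin
      enum (σ (σ i))        ≈⟨ trans (enum-transport (_+ 1#) (σ i)) (+-congʳ (enum-transport (_+ 1#) i)) ⟩
      (enum i + 1#) + 1#    ≈⟨ +-assoc _ _ _ ⟩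
      enum i + two          ≈⟨ +-congˡ two≈0 ⟩
      enum i + 0#           ≈⟨ +-identityʳ _ ⟩
      enum i                ∎)
    σ-free : ∀ i → σ i ≡.≢ i
    σ-free i σi≡i = x≉x+1 (sym (trans (sym (enum-transport (_+ 1#) i)) (reflexive (≡.cong enum σi≡i))))

  module SquareRootOfMinusOne (two≉0 : ¬ two ≈ 0#) (ι : Carrier) (ι²+1≈0 : ι * ι + 1# ≈ 0#) where

    ι≉0 : ¬ ι ≈ 0#
    ι≉0 ι≈0 = 0≉1 (sym (begin
      1#              ≈⟨ +-identityˡ 1# ⟨
      0# + 1#         ≈⟨ +-congʳ (trans (*-congˡ ι≈0) (zeroʳ ι)) ⟨
      ι * ι + 1#      ≈⟨ ι²+1≈0 ⟩
      0#              ∎))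

    σ : Fin q → Fin q
    σ = transport (ι *_)

    σ²+id≈0 : ∀ i → enum (σ (σ i)) + enum i ≈ 0#
    σ²+id≈0 i = begin
      enum (σ (σ i)) + enum i        ≈⟨ +-congʳ (trans (enum-transport (ι *_) (σ i)) (*-congˡ (enum-transport (ι *_) i))) ⟩
      ι * (ι * enum i) + enum i      ≈⟨ solve 2 (λ ι x → ι :* (ι :* x) :+ x := (ι :* ι :+ con 1) :* x) refl ι (enum i) ⟩
      (ι * ι + 1#) * enum i          ≈⟨ *-congʳ ι²+1≈0 ⟩
      0# * enum i                    ≈⟨ zeroˡ _ ⟩
      0#                             ∎

    σ⁴≡id : ∀ i → σ (σ (σ (σ i))) ≡ i
    σ⁴≡id i = enum-inj _ _ (+-cancelʳ (trans (σ²+id≈0 (σ (σ i))) (trans (sym (σ²+id≈0 i)) (+-comm _ _))))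

    nonzero-σ : ∀ i → nonzero (σ i) ≡ nonzero i
    nonzero-σ i = ≡.cong not (does-⇔ (mk⇔ to from) (enum (σ i) ≟ 0#) (enum i ≟ 0#))
      where
      to : enum (σ i) ≈ 0# → enum i ≈ 0#
      to σi≈0 with x*y≈0⇒x≈0⊎y≈0 (trans (sym (enum-transport (ι *_) i)) σi≈0)
      ... | inj₁ ι≈0 = ⊥-elim (ι≉0 ι≈0)
      ... | inj₂ i≈0 = i≈0
      from : enum i ≈ 0# → enum (σ i) ≈ 0#
      from i≈0 = trans (enum-transport (ι *_) i) (trans (*-congˡ i≈0) (zeroʳ ι))

    σ²-free : ∀ i → ¬ enum i ≈ 0# → σ (σ i) ≡.≢ i
    σ²-free i i≉0 σ²i≡i with x*y≈0⇒x≈0⊎y≈0 (begin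
      two * enum i                   ≈⟨ solve 1 (λ x → con 2 :* x := x :+ x) refl (enum i) ⟩
      enum i + enum i                ≈⟨ +-congʳ (reflexive (≡.cong enum σ²i≡i)) ⟨
      enum (σ (σ i)) + enum i        ≈⟨ σ²+id≈0 i ⟩
      0#                             ∎)
    ... | inj₁ two≈0 = two≉0 two≈0
    ... | inj₂ i≈0   = i≉0 i≈0

    4∣#nonzero : 4 ∣ count nonzero
    4∣#nonzero = order4⇒4∣count nonzero σ σ⁴≡id nonzero-σ (λ i nz → σ²-free i (T-not-does (enum i ≟ 0#) nz))

  a²+c²≈0⇒[a/c]²+1≈0 : ∀ {a c} (c≉0 : ¬ c ≈ 0#) → a * a + c * c ≈ 0# →
                       let c⁻¹ = proj₁ (inverse c c≉0) in (a * c⁻¹) * (a * c⁻¹) + 1# ≈ 0#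
  a²+c²≈0⇒[a/c]²+1≈0 {a} {c} c≉0 a²+c²≈0 = begin
    (a * c⁻¹) * (a * c⁻¹) + 1#                  ≈⟨ +-congˡ (trans (*-cong c*c⁻¹≈1 c*c⁻¹≈1) (*-identityˡ 1#)) ⟨
    (a * c⁻¹) * (a * c⁻¹) + (c * c⁻¹) * (c * c⁻¹) ≈⟨ solve 3 (λ a c c⁻¹ → (a :* c⁻¹) :* (a :* c⁻¹) :+ (c :* c⁻¹) :* (c :* c⁻¹)
                                                                := (a :* a :+ c :* c) :* (c⁻¹ :* c⁻¹)) refl a c c⁻¹ ⟩
    (a * a + c * c) * (c⁻¹ * c⁻¹)               ≈⟨ *-congʳ a²+c²≈0 ⟩
    0# * (c⁻¹ * c⁻¹)                            ≈⟨ zeroˡ _ ⟩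
    0#                                          ∎
    where
    c⁻¹ = proj₁ (inverse c c≉0)
    c*c⁻¹≈1 = proj₂ (inverse c c≉0)

  module _ (q%4≡3 : q % 4 ≡ 3) where

    q%4≡3⇒two≉0 : ¬ two ≈ 0#
    q%4≡3⇒two≉0 = q%4≡3⇒2∤q q%4≡3 ∘ two≈0⇒2∣q

    q%4≡3⇒a²+c²≈0⇒c≈0 : ∀ a c → a * a + c * c ≈ 0# → c ≈ 0#
    q%4≡3⇒a²+c²≈0⇒c≈0 a c a²+c²≈0 with c ≟ 0#
    ... | yes c≈0 = c≈0
    ... | no  c≉0 = ⊥-elim (q%4≡3⇒4∤q-1 q%4≡3 q≡#nonzero+1 (SquareRootOfMinusOne.4∣#nonzero
                      q%4≡3⇒two≉0 _ (a²+c²≈0⇒[a/c]²+1≈0 c≉0 a²+c²≈0)))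

  data η-View (u : Carrier) : ℤ → Set where
    null       : u ≈ 0# → η-View u (+ 0)
    residue    : ¬ u ≈ 0# → ∃ (λ i → enum i * enum i ≈ u) → η-View u (+ 1)
    nonresidue : ¬ u ≈ 0# → η-View u -[1+ 0 ]

  η-view : ∀ u → η-View u (η K u)
  η-view u = view (u ≟ 0#) (any? (λ i → (enum i * enum i) ≟ u))
    where
    view : (u≟0 : Dec (u ≈ 0#)) (square? : Dec (∃ λ i → enum i * enum i ≈ u)) →
           η-View u (if does u≟0 then + 0 else if does square? then + 1 else -[1+ 0 ])
    view (yes u≈0) _          = null u≈0
    view (no u≉0)  (yes root) = residue u≉0 root
    view (no u≉0)  (no _)     = nonresidue u≉0

  QR : Carrier → Set
  QR u = η K u ≡ + 1

  QR? : ∀ u → Dec (QR u)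
  QR? u = η K u ℤ.≟ + 1

  QR⇒≉0 : ∀ {u} → QR u → ¬ u ≈ 0#
  QR⇒≉0 {u} ηu≡1 with η K u | η-view u
  QR⇒≉0 ≡.refl | _ | residue u≉0 _ = u≉0

  QR⇒square : ∀ {u} → QR u → ∃ λ a → a * a ≈ u
  QR⇒square {u} ηu≡1 with η K u | η-view u
  QR⇒square ≡.refl | _ | residue _ (i , root) = enum i , root

  ¬QR⇒η≡-1 : ∀ {u} → ¬ QR u → ¬ u ≈ 0# → η K u ≡ -[1+ 0 ]
  ¬QR⇒η≡-1 {u} ¬qr u≉0 with η K u | η-view u
  ... | _ | null u≈0        = ⊥-elim (u≉0 u≈0)
  ... | _ | residue _ _     = ⊥-elim (¬qr ≡.refl)
  ... | _ | nonresidue _    = ≡.refl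

  F-QR : ∀ {u} → QR u → F K u ≈ two * (u * u)
  F-QR {u} ηu≡1 rewrite ηu≡1 = solve 1 (λ u → (u :* u) :* (con 1 :+ (con 1 :+ con 0)) := con 2 :* (u :* u)) refl u

  F-¬QR : ∀ {u} → ¬ QR u → F K u ≈ 0#
  F-¬QR {u} ¬qr with η K u | η-view u
  ... | _ | null u≈0     = trans (*-congʳ (*-congˡ u≈0)) (trans (*-congʳ (zeroʳ u)) (zeroˡ _))
  ... | _ | residue _ _  = ⊥-elim (¬qr ≡.refl)
  ... | _ | nonresidue _ = trans (*-congˡ (trans (+-congˡ (-‿cong (+-identityʳ 1#))) (-‿inverseʳ 1#))) (zeroʳ _)

  InC : Fin 2 → Fin 2 → Carrier → Set
  InC i j u = η K u ≡ sgn K i × η K (u + 1#) ≡ sgn K j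

  -- F x - F y = b stated additively, so that the natural-coefficient ring solver applies.
  Solution : Carrier → Carrier → Carrier → Set
  Solution b x y = F K x ≈ b + F K y × F K (x + 1#) ≈ b + F K (y + 1#)

  InA : Fin 2 → Fin 2 → Fin 2 → Fin 2 → Carrier → Carrier → Carrier → Set
  InA i j k l b x y = Solution b x y × InC i j x × InC k l y

  Solution-swap : ∀ {b x y} → Solution b x y → Solution (- b) y x
  Solution-swap (E₁ , E₂) = x≈b+y⇒y≈-b+x E₁ , x≈b+y⇒y≈-b+x E₂

  η≡-1⇒¬QR : ∀ {u} → η K u ≡ -[1+ 0 ] → ¬ QR u
  η≡-1⇒¬QR ηu≡-1 ηu≡1 with ≡.trans (≡.sym ηu≡-1) ηu≡1
  ... | ()

  F≈b+F¬QR⇒F≈b : ∀ {b u v} → F K u ≈ b + F K v → ¬ QR v → F K u ≈ b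
  F≈b+F¬QR⇒F≈b {b} E ¬qr = trans E (trans (+-congˡ (F-¬QR ¬qr)) (+-identityʳ b))

  TwiceNonzeroSquare : Carrier → Set
  TwiceNonzeroSquare b = ∃ λ a → ¬ a ≈ 0# × b ≈ two * (a * a)

  TwiceNonzeroSquare? : ∀ b → Dec (TwiceNonzeroSquare b)
  TwiceNonzeroSquare? b = Dec.map′ (λ (i , h) → enum i , h) from
    (any? (λ i → ¬? (enum i ≟ 0#) ×-dec (b ≟ (two * (enum i * enum i)))))
    where
    from : TwiceNonzeroSquare b → ∃ λ i → ¬ enum i ≈ 0# × b ≈ two * (enum i * enum i)
    from (a , a≉0 , b≈2a²) = i , (λ i≈0 → a≉0 (trans (sym i≈a) i≈0)) , trans b≈2a² (*-congˡ (sym (*-cong i≈a i≈a)))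
      where i = proj₁ (enum-sur a)
            i≈a = proj₂ (enum-sur a)

  module Solutions (two≉0 : ¬ two ≈ 0#) (a²+c²≈0⇒c≈0 : ∀ a c → a * a + c * c ≈ 0# → c ≈ 0#) where

    private variable a b c u v x y x' y' : Carrier

    two*≈0⇒≈0 : two * u ≈ 0# → u ≈ 0#
    two*≈0⇒≈0 {u} 2u≈0 = *-cancelˡ two≉0 (trans 2u≈0 (sym (zeroʳ two)))

    QR⇒+1≉0 : QR u → ¬ u + 1# ≈ 0#
    QR⇒+1≉0 qr u+1≈0 with QR⇒square qr
    ... | a , a²≈u = 0≉1 (sym (a²+c²≈0⇒c≈0 a 1# (trans (+-cong a²≈u (*-identityˡ 1#)) u+1≈0)))

    twice-squares≉0 : ¬ c ≈ 0# → ¬ two * (a * a) + two * (c * c) ≈ 0#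
    twice-squares≉0 {c} {a} c≉0 sum≈0 = c≉0 (a²+c²≈0⇒c≈0 a c (two*≈0⇒≈0 (trans (distribˡ two _ _) sum≈0)))

    QR-square-injective : QR u → QR v → u * u ≈ v * v → u ≈ v
    QR-square-injective {u} {v} qu qv u²≈v² with (u + v) ≟ 0#
    ... | no u+v≉0 = +-cancelʳ (*-cancelʳ u+v≉0 (begin
      (u + v) * (u + v)            ≈⟨ solve 2 (λ u v → (u :+ v) :* (u :+ v) := u :* u :+ (con 2 :* (u :* v) :+ v :* v)) refl u v ⟩
      u * u + (two * (u * v) + v * v) ≈⟨ +-congʳ u²≈v² ⟩
      v * v + (two * (u * v) + v * v) ≈⟨ solve 2 (λ u v → v :* v :+ (con 2 :* (u :* v) :+ v :* v) := (v :+ v) :* (u :+ v)) refl u v ⟩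
      (v + v) * (u + v)            ∎))
    ... | yes u+v≈0 with QR⇒square qu | QR⇒square qv
    ...   | a , a²≈u | c , c²≈v = ⊥-elim (QR⇒≉0 qv (begin
      v          ≈⟨ c²≈v ⟨
      c * c      ≈⟨ *-congʳ c≈0 ⟩
      0# * c     ≈⟨ zeroˡ c ⟩
      0#         ∎))
      where c≈0 = a²+c²≈0⇒c≈0 a c (trans (+-cong a²≈u c²≈v) u+v≈0)

    F-QR-injective : QR u → QR v → F K u ≈ F K v → u ≈ v
    F-QR-injective qu qv Fu≈Fv =
      QR-square-injective qu qv (*-cancelˡ two≉0 (trans (sym (F-QR qu)) (trans Fu≈Fv (F-QR qv))))

    F-QR-cong : QR u → QR v → u ≈ v → F K u ≈ F K v
    F-QR-cong qu qv u≈v = trans (F-QR qu) (trans (*-congˡ (*-cong u≈v u≈v)) (sym (F-QR qv)))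

    F-QR-succ : QR u → QR (u + 1#) → F K (u + 1#) ≈ F K u + (two * (two * u) + two)
    F-QR-succ {u} qu qu₁ = begin
      F K (u + 1#)                            ≈⟨ F-QR qu₁ ⟩
      two * ((u + 1#) * (u + 1#))             ≈⟨ solve 1 (λ u → con 2 :* ((u :+ con 1) :* (u :+ con 1))
                                                              := con 2 :* (u :* u) :+ (con 2 :* (con 2 :* u) :+ con 2)) refl u ⟩
      two * (u * u) + (two * (two * u) + two) ≈⟨ +-congʳ (F-QR qu) ⟨
      F K u + (two * (two * u) + two)         ∎

    ¬QR-¬QR⇒b≈0 : F K u ≈ b + F K v → ¬ QR u → ¬ QR v → b ≈ 0#
    ¬QR-¬QR⇒b≈0 E ¬qu ¬qv = trans (sym (F≈b+F¬QR⇒F≈b E ¬qv)) (F-¬QR ¬qu)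

    -- R and N record whether η is 1 or not at x, x + 1, y and y + 1, in this order.
    ¬RR-NN : Solution b x y → QR x → QR (x + 1#) → ¬ QR y → ¬ QR (y + 1#) → ⊥
    ¬RR-NN (E₁ , E₂) qx qx₁ ¬qy ¬qy₁ =
      x≉x+1 (F-QR-injective qx qx₁ (trans (F≈b+F¬QR⇒F≈b E₁ ¬qy) (sym (F≈b+F¬QR⇒F≈b E₂ ¬qy₁))))

    ¬RN-NR : Solution b x y → QR x → ¬ QR (x + 1#) → ¬ QR y → QR (y + 1#) → ⊥
    ¬RN-NR {b} {x} {y} (E₁ , E₂) qx ¬qx₁ ¬qy qy₁ = twice-squares≉0 (QR⇒≉0 qy₁) (begin
      two * (x * x) + two * ((y + 1#) * (y + 1#))   ≈⟨ +-cong (F-QR qx) (F-QR qy₁) ⟨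
      F K x + F K (y + 1#)                          ≈⟨ +-congʳ (F≈b+F¬QR⇒F≈b E₁ ¬qy) ⟩
      b + F K (y + 1#)                              ≈⟨ E₂ ⟨
      F K (x + 1#)                                  ≈⟨ F-¬QR ¬qx₁ ⟩
      0#                                            ∎)

    RR-NR⇒y≉0 : Solution b x y → QR x → QR (x + 1#) → ¬ QR y → QR (y + 1#) → ¬ y ≈ 0#
    RR-NR⇒y≉0 {b} {x} {y} (E₁ , E₂) qx qx₁ ¬qy qy₁ y≈0 = QR⇒≉0 qx (two*≈0⇒≈0 (two*≈0⇒≈0 (+-cancelʳ (+-cancelˡ (begin
      F K x + (two * (two * x) + two)     ≈⟨ F-QR-succ qx qx₁ ⟨
      F K (x + 1#)                        ≈⟨ E₂ ⟩
      b + F K (y + 1#)                    ≈⟨ +-cong (F≈b+F¬QR⇒F≈b E₁ ¬qy) (sym (F-QR qy₁)) ⟨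
      F K x + two * ((y + 1#) * (y + 1#)) ≈⟨ +-congˡ (*-congˡ (*-cong y+1≈1 y+1≈1)) ⟩
      F K x + two * (1# * 1#)             ≈⟨ +-congˡ (solve 0 (con 2 :* (con 1 :* con 1) := con 0 :+ con 2) refl) ⟩
      F K x + (0# + two)                  ∎)))))
      where y+1≈1 = trans (+-congʳ y≈0) (+-identityˡ 1#)

    RR-RR⇒b≈0 : Solution b x y → QR x → QR (x + 1#) → QR y → QR (y + 1#) → b ≈ 0#
    RR-RR⇒b≈0 {b} {x} {y} (E₁ , E₂) qx qx₁ qy qy₁ = +-cancelʳ (begin
      b + F K y     ≈⟨ E₁ ⟨
      F K x         ≈⟨ F-QR-cong qx qy x≈y ⟩
      F K y         ≈⟨ +-identityˡ _ ⟨
      0# + F K y    ∎)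
      where
      x≈y : x ≈ y
      x≈y = *-cancelˡ two≉0 (*-cancelˡ two≉0 (+-cancelʳ (+-cancelˡ (begin
        (b + F K y) + (two * (two * x) + two) ≈⟨ +-congʳ E₁ ⟨
        F K x + (two * (two * x) + two)       ≈⟨ F-QR-succ qx qx₁ ⟨
        F K (x + 1#)                          ≈⟨ E₂ ⟩
        b + F K (y + 1#)                      ≈⟨ +-congˡ (F-QR-succ qy qy₁) ⟩
        b + (F K y + (two * (two * y) + two)) ≈⟨ +-assoc _ _ _ ⟨
        (b + F K y) + (two * (two * y) + two) ∎))))

    Classified : Carrier → Carrier → Set
    Classified x y = (InC 0F 0F x × InC 0F 1F y) ⊎ (InC 0F 0F x × InC 1F 0F y)
                   ⊎ (InC 0F 1F x × InC 0F 0F y) ⊎ (InC 1F 0F x × InC 0F 0F y)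

    classify : ¬ b ≈ 0# → Solution b x y → Classified x y
    classify {b} {x} {y} b≉0 sol@(E₁ , E₂) with QR? x | QR? (x + 1#) | QR? y | QR? (y + 1#)
    ... | no ¬qx | _       | no ¬qy | _       = ⊥-elim (b≉0 (¬QR-¬QR⇒b≈0 E₁ ¬qx ¬qy))
    ... | _      | no ¬qx₁ | _      | no ¬qy₁ = ⊥-elim (b≉0 (¬QR-¬QR⇒b≈0 E₂ ¬qx₁ ¬qy₁))
    ... | yes qx | yes qx₁ | no ¬qy | no ¬qy₁ = ⊥-elim (¬RR-NN sol qx qx₁ ¬qy ¬qy₁)
    ... | no ¬qx | no ¬qx₁ | yes qy | yes qy₁ = ⊥-elim (¬RR-NN (Solution-swap sol) qy qy₁ ¬qx ¬qx₁)
    ... | yes qx | no ¬qx₁ | no ¬qy | yes qy₁ = ⊥-elim (¬RN-NR sol qx ¬qx₁ ¬qy qy₁)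
    ... | no ¬qx | yes qx₁ | yes qy | no ¬qy₁ = ⊥-elim (¬RN-NR (Solution-swap sol) qy ¬qy₁ ¬qx qx₁)
    ... | yes qx | yes qx₁ | yes qy | yes qy₁ = ⊥-elim (b≉0 (RR-RR⇒b≈0 sol qx qx₁ qy qy₁))
    ... | yes qx | yes qx₁ | yes qy | no ¬qy₁ =
      inj₁ ((qx , qx₁) , (qy , ¬QR⇒η≡-1 ¬qy₁ (QR⇒+1≉0 qy)))
    ... | yes qx | yes qx₁ | no ¬qy | yes qy₁ =
      inj₂ (inj₁ ((qx , qx₁) , (¬QR⇒η≡-1 ¬qy (RR-NR⇒y≉0 sol qx qx₁ ¬qy qy₁) , qy₁)))
    ... | yes qx | no ¬qx₁ | yes qy | yes qy₁ =
      inj₂ (inj₂ (inj₁ ((qx , ¬QR⇒η≡-1 ¬qx₁ (QR⇒+1≉0 qx)) , (qy , qy₁))))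
    ... | no ¬qx | yes qx₁ | yes qy | yes qy₁ =
      inj₂ (inj₂ (inj₂ ((¬QR⇒η≡-1 ¬qx (RR-NR⇒y≉0 (Solution-swap sol) qy qy₁ ¬qx qx₁) , qx₁) , (qy , qy₁))))

    InA-swap-00-01 : InA 0F 1F 0F 0F b x y → InA 0F 0F 0F 1F (- b) y x
    InA-swap-00-01 (sol , cx , cy) = Solution-swap sol , cy , cx

    InA-swap-00-10 : InA 1F 0F 0F 0F b x y → InA 0F 0F 1F 0F (- b) y x
    InA-swap-00-10 (sol , cx , cy) = Solution-swap sol , cy , cx

    unique-00-01 : InA 0F 0F 0F 1F b x y → InA 0F 0F 0F 1F b x' y' → x ≈ x' × y ≈ y'
    unique-00-01 ((E₁ , E₂) , (qx , qx₁) , (qy , ηy₁)) ((E₁' , E₂') , (qx' , qx₁') , (qy' , ηy₁')) = x≈x' , y≈y'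
      where
      x≈x' = +-cancelʳ (F-QR-injective qx₁ qx₁'
               (trans (F≈b+F¬QR⇒F≈b E₂ (η≡-1⇒¬QR ηy₁)) (sym (F≈b+F¬QR⇒F≈b E₂' (η≡-1⇒¬QR ηy₁')))))
      y≈y' = F-QR-injective qy qy' (+-cancelˡ (trans (sym E₁) (trans (F-QR-cong qx qx' x≈x') E₁')))

    unique-00-10 : InA 0F 0F 1F 0F b x y → InA 0F 0F 1F 0F b x' y' → x ≈ x' × y ≈ y'
    unique-00-10 ((E₁ , E₂) , (qx , qx₁) , (ηy , qy₁)) ((E₁' , E₂') , (qx' , qx₁') , (ηy' , qy₁')) = x≈x' , y≈y'
      where
      x≈x' = F-QR-injective qx qx'
               (trans (F≈b+F¬QR⇒F≈b E₁ (η≡-1⇒¬QR ηy)) (sym (F≈b+F¬QR⇒F≈b E₁' (η≡-1⇒¬QR ηy'))))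
      y≈y' = +-cancelʳ (F-QR-injective qy₁ qy₁'
               (+-cancelˡ (trans (sym E₂) (trans (F-QR-cong qx₁ qx₁' (+-congʳ x≈x')) E₂'))))

    unique-01-00 : InA 0F 1F 0F 0F b x y → InA 0F 1F 0F 0F b x' y' → x ≈ x' × y ≈ y'
    unique-01-00 a a' = swap (unique-00-01 (InA-swap-00-01 a) (InA-swap-00-01 a'))

    unique-10-00 : InA 1F 0F 0F 0F b x y → InA 1F 0F 0F 0F b x' y' → x ≈ x' × y ≈ y'
    unique-10-00 a a' = swap (unique-00-10 (InA-swap-00-10 a) (InA-swap-00-10 a'))

    00-01⇒twice-square : InA 0F 0F 0F 1F b x y → TwiceNonzeroSquare b
    00-01⇒twice-square {x = x} ((_ , E₂) , (_ , qx₁) , (_ , ηy₁)) =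
      x + 1# , QR⇒≉0 qx₁ , trans (sym (F≈b+F¬QR⇒F≈b E₂ (η≡-1⇒¬QR ηy₁))) (F-QR qx₁)

    00-10⇒twice-square : InA 0F 0F 1F 0F b x y → TwiceNonzeroSquare b
    00-10⇒twice-square {x = x} ((E₁ , _) , (qx , _) , (ηy , _)) =
      x , QR⇒≉0 qx , trans (sym (F≈b+F¬QR⇒F≈b E₁ (η≡-1⇒¬QR ηy))) (F-QR qx)

    ¬twice-square-both-signs : TwiceNonzeroSquare b → ¬ TwiceNonzeroSquare (- b)
    ¬twice-square-both-signs {b} (a , _ , b≈2a²) (c , c≉0 , -b≈2c²) =
      twice-squares≉0 c≉0 (trans (sym (+-cong b≈2a² -b≈2c²)) (-‿inverseʳ b))

  T-isSol⇒Solution : ∀ {b x y} → T (isSol K b x y) → Solution b x y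
  T-isSol⇒Solution {b} {x} {y} t with Equivalence.to T-∧ t
  ... | E₁ , E₂ = x-y≈b⇒x≈b+y (T-does ((F K x - F K y) ≟ b) E₁)
                , x-y≈b⇒x≈b+y (T-does ((F K (x + 1#) - F K (y + 1#)) ≟ b) E₂)

  T-inC⇒InC : ∀ {i j u} → T (inC K i j u) → InC i j u
  T-inC⇒InC {i} {j} {u} t with Equivalence.to T-∧ t
  ... | e₁ , e₂ = T-does (η K u ℤ.≟ sgn K i) e₁ , T-does (η K (u + 1#) ℤ.≟ sgn K j) e₂

  T-A⇒InA : ∀ {i j k l b x y} → T (isSol K b x y ∧ inC K i j x ∧ inC K k l y) → InA i j k l b x y
  T-A⇒InA t with Equivalence.to T-∧ t
  ... | sol , t′ with Equivalence.to T-∧ t′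
  ...   | cx , cy = T-isSol⇒Solution sol , T-inC⇒InC cx , T-inC⇒InC cy

  #A≤1 : ∀ i j k l b → (∀ {x y x' y'} → InA i j k l b x y → InA i j k l b x' y' → x ≈ x' × y ≈ y') →
         #A K i j k l b ℕ.≤ 1
  #A≤1 _ _ _ _ _ unique = length-filterᵇ≤1 _ (cartesianProduct⁺ (allFin⁺ q) (allFin⁺ q)) λ {(i , j)} {(i' , j')} t t' →
    let x≈x' , y≈y' = unique (T-A⇒InA t) (T-A⇒InA t') in ≡.cong₂ _,_ (enum-inj i i' x≈x') (enum-inj j j' y≈y')

  #A≡0 : ∀ i j k l b → (∀ {x y} → ¬ InA i j k l b x y) → #A K i j k l b ≡ 0
  #A≡0 _ _ _ _ _ empty = length-filterᵇ≡0 _ (λ (i , j) t → empty (T-A⇒InA t)) (pairs K)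

-- ℕ's _+_ is opened only from here on: above, it would clash with the field's _+_.
open import Data.Nat using (ℕ; _≤_; _%_; _+_)
open import Data.Fin using (zero; suc)
open import Data.Product using (_×_)
open import Data.Sum using (_⊎_)
open import Relation.Nullary using (¬_)
open import Relation.Binary.PropositionalEquality using (_≡_)
open import Function.Bundles using (_⇔_)

module ClassCounts {q : ℕ} (K : FiniteField q) (q%4≡3 : q % 4 ≡ 3)
  (b : FiniteField.Carrier K) (b≉0 : ¬ FiniteField._≈_ K b (FiniteField.0# K)) where

  open FiniteField K using (enum)
  open Properties K
  open Solutions (q%4≡3⇒two≉0 q%4≡3) (q%4≡3⇒a²+c²≈0⇒c≈0 q%4≡3)

  indicator-isSol : ∀ x y → indicator (isSol K b x y)
    ≡ indicator (isSol K b x y ∧ inC K 0F 0F x ∧ inC K 0F 1F y) + indicator (isSol K b x y ∧ inC K 0F 0F x ∧ inC K 1F 0F y)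
      + indicator (isSol K b x y ∧ inC K 0F 1F x ∧ inC K 0F 0F y) + indicator (isSol K b x y ∧ inC K 1F 0F x ∧ inC K 0F 0F y)
  indicator-isSol x y with isSol K b x y in isSol≡
  ... | false = ≡.refl
  ... | true with classify b≉0 (T-isSol⇒Solution (Equivalence.from T-≡ isSol≡))
  ...   | inj₁ ((ηx , ηx₁) , (ηy , ηy₁))               rewrite ηx | ηx₁ | ηy | ηy₁ = ≡.refl
  ...   | inj₂ (inj₁ ((ηx , ηx₁) , (ηy , ηy₁)))        rewrite ηx | ηx₁ | ηy | ηy₁ = ≡.refl
  ...   | inj₂ (inj₂ (inj₁ ((ηx , ηx₁) , (ηy , ηy₁)))) rewrite ηx | ηx₁ | ηy | ηy₁ = ≡.refl
  ...   | inj₂ (inj₂ (inj₂ ((ηx , ηx₁) , (ηy , ηy₁)))) rewrite ηx | ηx₁ | ηy | ηy₁ = ≡.refl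

  βF≡Σ#A : βF K b ≡ #A K 0F 0F 0F 1F b + #A K 0F 0F 1F 0F b + #A K 0F 1F 0F 0F b + #A K 1F 0F 0F 0F b
  βF≡Σ#A = length-filterᵇ-+₄ _ _ _ _ _ (λ (i , j) → indicator-isSol (enum i) (enum j)) (pairs K)

  #A-00-01≤1 : #A K 0F 0F 0F 1F b ≤ 1
  #A-00-01≤1 = #A≤1 0F 0F 0F 1F b unique-00-01

  #A-00-10≤1 : #A K 0F 0F 1F 0F b ≤ 1
  #A-00-10≤1 = #A≤1 0F 0F 1F 0F b unique-00-10

  #A-01-00≤1 : #A K 0F 1F 0F 0F b ≤ 1
  #A-01-00≤1 = #A≤1 0F 1F 0F 0F b unique-01-00

  #A-10-00≤1 : #A K 1F 0F 0F 0F b ≤ 1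
  #A-10-00≤1 = #A≤1 1F 0F 0F 0F b unique-10-00

  positive-or-negative-classes-empty :
    (#A K 0F 0F 0F 1F b ≡ 0 × #A K 0F 0F 1F 0F b ≡ 0) ⊎ (#A K 0F 1F 0F 0F b ≡ 0 × #A K 1F 0F 0F 0F b ≡ 0)
  positive-or-negative-classes-empty with TwiceNonzeroSquare? b
  ... | yes pos = inj₂ ( #A≡0 0F 1F 0F 0F b (¬twice-square-both-signs pos ∘ 00-01⇒twice-square ∘ InA-swap-00-01)
                       , #A≡0 1F 0F 0F 0F b (¬twice-square-both-signs pos ∘ 00-10⇒twice-square ∘ InA-swap-00-10))
  ... | no ¬pos = inj₁ ( #A≡0 0F 0F 0F 1F b (¬pos ∘ 00-01⇒twice-square)
                       , #A≡0 0F 0F 1F 0F b (¬pos ∘ 00-10⇒twice-square))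

corollary4 : (q : ℕ) → (K : FiniteField q) → q % 4 ≡ 3 →
    (b : FiniteField.Carrier K) → ¬ (FiniteField._≈_ K b (FiniteField.0# K)) →
    (βF K b ≡ #A K zero zero zero (suc zero) b + #A K zero zero (suc zero) zero b
                + #A K zero (suc zero) zero zero b + #A K (suc zero) zero zero zero b)
    × (βF K b ≤ 2)
    × (βF K b ≡ 2 ⇔ ((#A K zero zero zero (suc zero) b ≡ 1 × #A K zero zero (suc zero) zero b ≡ 1)
                     ⊎ (#A K zero (suc zero) zero zero b ≡ 1 × #A K (suc zero) zero zero zero b ≡ 1)))
corollary4 q K q%4≡3 b b≉0 rewrite ClassCounts.βF≡Σ#A K q%4≡3 b b≉0 =
  ≡.refl , four-bits #A-00-01≤1 #A-00-10≤1 #A-01-00≤1 #A-10-00≤1 positive-or-negative-classes-empty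
  where open ClassCounts K q%4≡3 b b≉0
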